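{- For a graph $G$ let $s(G)$ be the maximum size of a set $S\subseteq V(G)$ such that $S$ is stable and no vertex of $G$ is adjacent to two vertices of $S$. Then the proportion of graphs of girth at least five on vertex set $\{1,\dots,n\}$ for which $s(G)>3n^{9/10}$ is $2^{ -\omega(n)}$ as $n\to\infty$.
   Context: Girth at least five means no cycle of length 3 or 4. $2^{ -\omega(n)}$ means a quantity $2^{ -g(n)}$ with $g(n)/n\to\infty$. -}

module Defs where

open import Data.Nat using (ℕ; zero; suc; _+_; _*_; _^_; _<_; _≤_; _⊔_; _<?_)
open import Data.Bool using (Bool; true; false; _∧_; _∨_; not; if_then_else_)
open import Data.Fin using (Fin; zero; suc; _≟_)
open import Data.List using (List; []; _∷_; map; filter; foldr; length; concatMap; allFin)
open import Data.Vec using (Vec; []; _∷_; lookup)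
open import Data.Product using (_×_; _,_)
open import Data.Unit using (⊤; tt)
open import Relation.Nullary.Decidable using (⌊_⌋)
open import Relation.Unary using (Decidable)
open import Data.Bool.Properties using (T?)

Subset : ℕ → Set
Subset n = Vec Bool n

∣_∣ : ∀ {n} → Subset n → ℕ
∣ [] ∣ = 0
∣ true ∷ S ∣ = suc ∣ S ∣
∣ false ∷ S ∣ = ∣ S ∣

allSubsets : (n : ℕ) → List (Subset n)
allSubsets zero = [] ∷ []
allSubsets (suc n) = concatMap (λ S → (true ∷ S) ∷ (false ∷ S) ∷ []) (allSubsets n)

-- A graph on Fin (suc n) is a graph on the vertices suc i (a copy of Fin n)
-- together with the neighbourhood (a subset of Fin n) of the vertex zero.
-- This is a bijective encoding of simple graphs on n labelled vertices.
Graph : ℕ → Set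
Graph zero = ⊤
Graph (suc n) = Graph n × Subset n

-- Adjacency (symmetric and irreflexive by construction).
adj : ∀ {n} → Graph n → Fin n → Fin n → Bool
adj {suc n} (G , N) zero zero = false
adj {suc n} (G , N) zero (suc j) = lookup N j
adj {suc n} (G , N) (suc i) zero = lookup N i
adj {suc n} (G , N) (suc i) (suc j) = adj G i j

allGraphs : (n : ℕ) → List (Graph n)
allGraphs zero = tt ∷ []
allGraphs (suc n) = concatMap (λ G → map (λ N → (G , N)) (allSubsets n)) (allGraphs n)

∀F : ∀ {n} → (Fin n → Bool) → Bool
∀F {n} p = foldr (λ i b → p i ∧ b) true (allFin n)

_≠_ : ∀ {n} → Fin n → Fin n → Bool
i ≠ j = not ⌊ i ≟ j ⌋

noTriangle : ∀ {n} → Graph n → Bool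
noTriangle G = ∀F λ a → ∀F λ b → ∀F λ c →
  not (adj G a b ∧ adj G b c ∧ adj G c a)

-- No cycle of length 4 (a b c d a with a,b,c,d distinct; adjacent vertices
-- are automatically distinct since the graph has no loops).
noFourCycle : ∀ {n} → Graph n → Bool
noFourCycle G = ∀F λ a → ∀F λ b → ∀F λ c → ∀F λ d →
  not (adj G a b ∧ adj G b c ∧ adj G c d ∧ adj G d a ∧ (a ≠ c) ∧ (b ≠ d))

girth≥5 : ∀ {n} → Graph n → Bool
girth≥5 G = noTriangle G ∧ noFourCycle G

stable : ∀ {n} → Graph n → Subset n → Bool
stable G S = ∀F λ u → ∀F λ v →
  not (lookup S u ∧ lookup S v ∧ adj G u v)

noCommonNbr : ∀ {n} → Graph n → Subset n → Bool
noCommonNbr G S = ∀F λ w → ∀F λ u → ∀F λ v →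
  not (lookup S u ∧ lookup S v ∧ (u ≠ v) ∧ adj G w u ∧ adj G w v)

s : ∀ {n} → Graph n → ℕ
s {n} G = foldr _⊔_ 0
  (map ∣_∣ (filter (λ S → T? (stable G S ∧ noCommonNbr G S)) (allSubsets n)))

-- s(G) > 3 n^(9/10)  ⇔  s(G)^10 > 3^10 n^9   (both sides nonnegative)
bigS : ∀ {n} → Graph n → Bool
bigS {n} G = ⌊ ((3 ^ 10) * (n ^ 9)) <? (s G ^ 10) ⌋

countGirth5 : ℕ → ℕ
countGirth5 n = length (filter (λ G → T? (girth≥5 G)) (allGraphs n))

countBad : ℕ → ℕ
countBad n = length (filter (λ G → T? (girth≥5 G ∧ bigS G)) (allGraphs n))

-- Let r = ⌊n^(1/10)⌋ and w = r³.  In the grid of points (x, y) with x < w, y < 2w², the lines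
-- y = ax + b with a < w, b < w² each contain w points and two of them meet at most once, so the
-- point–line incidence graph on K = 3w³ ≤ 3n^(9/10) vertices has no 4-cycle, and each of its
-- 2^(w⁴) = 2^(r¹²) subgraphs H has girth at least five.  If G has girth at least five and
-- s(G) > 3n^(9/10), some K-set S is stable with no two vertices of S sharing a neighbour.
-- Replacing G on S by H and deleting the edges between S and the rest keeps the girth at least
-- five, and (G, H) is recovered from the new graph together with the map sending each vertex to
-- its unique neighbour in S, if any.  Summing over the 2ⁿ sets S,
--   #{bad G} · 2^(r¹²) ≤ 2ⁿ (n+1)ⁿ · #{G of girth ≥ 5},
-- and as r¹² ≈ n^1.2, the factor 2^(r¹²) eventually exceeds 2^(Cn) · 2ⁿ (n+1)ⁿ for every C.

{-# OPTIONS --safe #-}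
module Submission where

open import Defs
open import Data.Nat using (ℕ; zero; suc; _+_; _*_; _^_; _≤_; _<_; _≥_; _⊔_; _≡ᵇ_; _<?_; z≤n; s≤s; NonZero)
open import Data.Nat.Properties
open import Data.Nat.ListAction using (sum)
open import Data.Bool using (Bool; true; false; T; not; _∧_; if_then_else_)
open import Data.Bool.Properties using (T?; T-∧; T-≡)
open import Data.Empty using (⊥; ⊥-elim)
open import Data.Unit using (tt)
open import Data.Maybe using (Maybe; just; nothing)
import Data.Maybe as Maybe
open import Data.Product using (_×_; _,_; proj₁; proj₂; ∃; ∃-syntax; uncurry)
open import Data.Sum using (_⊎_; inj₁; inj₂)
open import Data.Fin using (Fin; zero; suc; toℕ; fromℕ<; splitAt; join; _↑ˡ_; _↑ʳ_; combine; remQuot)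
import Data.Fin.Properties as Finₚ
open import Data.List using (List; []; _∷_; [_]; length; map; filterᵇ; foldr; concatMap; cartesianProductWith; cartesianProduct; allFin; _++_)
open import Data.List.Properties using (length-++; length-map; length-++-sucʳ; length-filter; map-cong; length-tabulate)
open import Data.List.Membership.Propositional using (_∈_; lose)
open import Data.List.Membership.Propositional.Properties
  using (∈-∃++; ∈-++⁻; ∈-++⁺ˡ; ∈-++⁺ʳ; ∈-map⁺; ∈-filter⁺; ∈-filter⁻; ∈-map∘filter⁻; ∈-allFin;
         ∈-cartesianProductWith⁺; ∈-cartesianProduct⁺; ∈-cartesianProduct⁻)
open import Data.List.Relation.Unary.Any using (Any; here; there)
open import Data.List.Relation.Unary.All as All using (All; []; _∷_)
import Data.List.Relation.Unary.All.Properties as All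
open import Data.List.Relation.Unary.Unique.Propositional using (Unique; []; _∷_)
import Data.List.Relation.Unary.Unique.Propositional.Properties as Unique
open import Data.Vec using (Vec; []; _∷_; lookup; tabulate)
open import Data.Vec.Properties using (∷-injective; lookup∘tabulate; tabulate∘lookup; tabulate-cong)
open import Function using (id; _∘_; flip; _⇔_; mk⇔; Equivalence)
open import Relation.Binary.PropositionalEquality hiding ([_])
open import Relation.Nullary using (¬_; yes; no)
open import Relation.Binary using (tri<; tri≈; tri>)
open import Data.Nat.Solver using (module +-*-Solver)
open +-*-Solver using (solve; _:+_; _:*_; _:^_; _:=_; con)
open import Relation.Nullary.Decidable using (toWitness; toWitnessFalse; fromWitnessFalse)
open import Algebra.Properties.CommutativeSemigroup +-commutativeSemigroup using (interchange)

open Equivalence using (to; from)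

private variable
  A B C : Set

countᵇ : (A → Bool) → List A → ℕ
countᵇ p xs = length (filterᵇ p xs)

countᵇ-∷ : (p : A → Bool) (x : A) (xs : List A) →
  countᵇ p (x ∷ xs) ≡ (if p x then 1 else 0) + countᵇ p xs
countᵇ-∷ p x xs with p x
... | true = refl
... | false = refl

sum-map-+ : (f g : A → ℕ) (xs : List A) →
  sum (map (λ x → f x + g x) xs) ≡ sum (map f xs) + sum (map g xs)
sum-map-+ f g [] = refl
sum-map-+ f g (x ∷ xs) =
  trans (cong (f x + g x +_) (sum-map-+ f g xs)) (interchange (f x) (g x) _ _)

sum-map-cong : {f g : A → ℕ} → (∀ x → f x ≡ g x) → (xs : List A) → sum (map f xs) ≡ sum (map g xs)
sum-map-cong f≗g xs = cong sum (map-cong f≗g xs)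

countᵇ-≤-sum : (p : A → Bool) (q : B → A → Bool) (Ss : List B) →
  (∀ {x} → T (p x) → Any (λ S → T (q S x)) Ss) →
  (xs : List A) → countᵇ p xs ≤ sum (map (λ S → countᵇ (q S) xs) Ss)
countᵇ-≤-sum p q Ss covered [] = z≤n
countᵇ-≤-sum p q Ss covered (x ∷ xs) = begin
  countᵇ p (x ∷ xs)                                         ≡⟨ countᵇ-∷ p x xs ⟩
  𝟙 p x + countᵇ p xs                                       ≤⟨ +-mono-≤ head-≤ (countᵇ-≤-sum p q Ss covered xs) ⟩
  sum (map (λ S → 𝟙 (q S) x) Ss) + sum (map (λ S → countᵇ (q S) xs) Ss)
                                                            ≡⟨ sum-map-+ (λ S → 𝟙 (q S) x) (λ S → countᵇ (q S) xs) Ss ⟨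
  sum (map (λ S → 𝟙 (q S) x + countᵇ (q S) xs) Ss)          ≡⟨ sum-map-cong (λ S → countᵇ-∷ (q S) x xs) Ss ⟨
  sum (map (λ S → countᵇ (q S) (x ∷ xs)) Ss)                ∎
  where
  open ≤-Reasoning
  𝟙 : (A → Bool) → A → ℕ
  𝟙 r y = if r y then 1 else 0
  any-≤-sum : ∀ {Ts} → Any (λ S → T (q S x)) Ts → 1 ≤ sum (map (λ S → 𝟙 (q S) x) Ts)
  any-≤-sum {S ∷ _} (here qSx) with q S x
  ... | true = s≤s z≤n
  any-≤-sum {S ∷ _} (there qSx) = ≤-trans (any-≤-sum qSx) (m≤n+m _ (𝟙 (q S) x))
  head-≤ : 𝟙 p x ≤ sum (map (λ S → 𝟙 (q S) x) Ss)
  head-≤ with p x in px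
  ... | false = z≤n
  ... | true = any-≤-sum (covered (subst T (sym px) tt))

sum-map-*-≤ : (f : A → ℕ) (c b : ℕ) (xs : List A) → (∀ {x} → x ∈ xs → f x * c ≤ b) →
  sum (map f xs) * c ≤ length xs * b
sum-map-*-≤ f c b [] bound = z≤n
sum-map-*-≤ f c b (x ∷ xs) bound = begin
  (f x + sum (map f xs)) * c     ≡⟨ *-distribʳ-+ c (f x) _ ⟩
  f x * c + sum (map f xs) * c   ≤⟨ +-mono-≤ (bound (here refl)) (sum-map-*-≤ f c b xs (bound ∘ there)) ⟩
  b + length xs * b              ∎
  where open ≤-Reasoning

length-≤-injectiveOn : (f : A → B) {xs : List A} {ys : List B} → Unique xs →
  (∀ {x y} → x ∈ xs → y ∈ xs → f x ≡ f y → x ≡ y) → (∀ {x} → x ∈ xs → f x ∈ ys) →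
  length xs ≤ length ys
length-≤-injectiveOn f {[]} _ _ _ = z≤n
length-≤-injectiveOn f {x ∷ xs} (x∉xs ∷ unique) injective into
  with as , bs , refl ← ∈-∃++ (into (here refl)) =
    ≤-trans (s≤s (length-≤-injectiveOn f unique (λ p q → injective (there p) (there q)) into′))
            (≤-reflexive (sym (length-++-sucʳ as (f x) bs)))
  where
  into′ : ∀ {y} → y ∈ xs → f y ∈ as ++ bs
  into′ {y} y∈xs with ∈-++⁻ as (into (there y∈xs))
  ... | inj₁ p = ∈-++⁺ˡ p
  ... | inj₂ (there p) = ∈-++⁺ʳ as p
  ... | inj₂ (here fy≡fx) = ⊥-elim (All.lookup x∉xs y∈xs (sym (injective (there y∈xs) (here refl) fy≡fx)))

concatMap-map≡cartesianProductWith : (f : A → B → C) (xs : List A) (ys : List B) →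
  concatMap (λ x → map (f x) ys) xs ≡ cartesianProductWith f xs ys
concatMap-map≡cartesianProductWith f [] ys = refl
concatMap-map≡cartesianProductWith f (x ∷ xs) ys =
  cong (map (f x) ys ++_) (concatMap-map≡cartesianProductWith f xs ys)

length-cartesianProductWith : (f : A → B → C) (xs : List A) (ys : List B) →
  length (cartesianProductWith f xs ys) ≡ length xs * length ys
length-cartesianProductWith f [] ys = refl
length-cartesianProductWith f (x ∷ xs) ys =
  trans (length-++ (map (f x) ys)) (cong₂ _+_ (length-map (f x) ys) (length-cartesianProductWith f xs ys))

allSubsets-suc : ∀ n → allSubsets (suc n) ≡ cartesianProductWith (flip _∷_) (allSubsets n) (true ∷ false ∷ [])
allSubsets-suc n = concatMap-map≡cartesianProductWith (flip _∷_) (allSubsets n) _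

length-allSubsets : ∀ n → length (allSubsets n) ≡ 2 ^ n
length-allSubsets zero = refl
length-allSubsets (suc n) = begin
  length (allSubsets (suc n))         ≡⟨ cong length (allSubsets-suc n) ⟩
  length (cartesianProductWith (flip _∷_) (allSubsets n) (true ∷ false ∷ []))
                                      ≡⟨ length-cartesianProductWith (flip _∷_) (allSubsets n) _ ⟩
  length (allSubsets n) * 2           ≡⟨ cong (_* 2) (length-allSubsets n) ⟩
  2 ^ n * 2                           ≡⟨ *-comm (2 ^ n) 2 ⟩
  2 ^ suc n                           ∎
  where open ≡-Reasoning

∈-allSubsets : ∀ {n} (S : Subset n) → S ∈ allSubsets n
∈-allSubsets [] = here refl
∈-allSubsets {suc n} (b ∷ S) =
  subst (b ∷ S ∈_) (sym (allSubsets-suc n)) (∈-cartesianProductWith⁺ (flip _∷_) (∈-allSubsets S) (∈-bool b))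
  where
  ∈-bool : ∀ b → b ∈ true ∷ false ∷ []
  ∈-bool true = here refl
  ∈-bool false = there (here refl)

allSubsets-unique : ∀ n → Unique (allSubsets n)
allSubsets-unique zero = [] ∷ []
allSubsets-unique (suc n) = subst Unique (sym (allSubsets-suc n))
  (Unique.cartesianProductWith⁺ (flip _∷_) (λ eq → let (b≡c , S≡T) = ∷-injective eq in S≡T , b≡c)
    (allSubsets-unique n) (((λ ()) ∷ []) ∷ [] ∷ []))

allGraphs-suc : ∀ n → allGraphs (suc n) ≡ cartesianProduct (allGraphs n) (allSubsets n)
allGraphs-suc n = concatMap-map≡cartesianProductWith _,_ (allGraphs n) (allSubsets n)

∈-allGraphs : ∀ {n} (G : Graph n) → G ∈ allGraphs n
∈-allGraphs {zero} tt = here refl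
∈-allGraphs {suc n} (G , N) =
  subst ((G , N) ∈_) (sym (allGraphs-suc n)) (∈-cartesianProduct⁺ (∈-allGraphs G) (∈-allSubsets N))

allGraphs-unique : ∀ n → Unique (allGraphs n)
allGraphs-unique zero = [] ∷ []
allGraphs-unique (suc n) = subst Unique (sym (allGraphs-suc n))
  (Unique.cartesianProduct⁺ (allGraphs-unique n) (allSubsets-unique n))

vectors : List A → (k : ℕ) → List (Vec A k)
vectors xs zero = [ [] ]
vectors xs (suc k) = cartesianProductWith _∷_ xs (vectors xs k)

length-vectors : (xs : List A) (k : ℕ) → length (vectors xs k) ≡ length xs ^ k
length-vectors xs zero = refl
length-vectors xs (suc k) =
  trans (length-cartesianProductWith _∷_ xs (vectors xs k)) (cong (length xs *_) (length-vectors xs k))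

∈-vectors : {xs : List A} → (∀ x → x ∈ xs) → ∀ {k} (v : Vec A k) → v ∈ vectors xs k
∈-vectors complete [] = here refl
∈-vectors complete (x ∷ v) = ∈-cartesianProductWith⁺ _∷_ (complete x) (∈-vectors complete v)

allMaybeFin : ∀ n → List (Maybe (Fin n))
allMaybeFin n = nothing ∷ map just (allFin n)

∈-allMaybeFin : ∀ {n} (m : Maybe (Fin n)) → m ∈ allMaybeFin n
∈-allMaybeFin nothing = here refl
∈-allMaybeFin (just i) = there (∈-map⁺ just (∈-allFin i))

length-allMaybeFin : ∀ n → length (allMaybeFin n) ≡ suc n
length-allMaybeFin n = cong suc (trans (length-map just (allFin n)) (length-tabulate {n = n} id))

adj-sym : ∀ {n} (G : Graph n) i j → adj G i j ≡ adj G j i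
adj-sym {suc n} (G , N) zero zero = refl
adj-sym {suc n} (G , N) zero (suc j) = refl
adj-sym {suc n} (G , N) (suc i) zero = refl
adj-sym {suc n} (G , N) (suc i) (suc j) = adj-sym G i j

adj-irrefl : ∀ {n} (G : Graph n) i → adj G i i ≡ false
adj-irrefl {suc n} (G , N) zero = refl
adj-irrefl {suc n} (G , N) (suc i) = adj-irrefl G i

Vec-ext : ∀ {n} {u v : Vec A n} → (∀ i → lookup u i ≡ lookup v i) → u ≡ v
Vec-ext {u = u} {v} u≗v = trans (sym (tabulate∘lookup u)) (trans (tabulate-cong u≗v) (tabulate∘lookup v))

Graph-ext : ∀ {n} {G H : Graph n} → (∀ i j → adj G i j ≡ adj H i j) → G ≡ H
Graph-ext {zero} _ = refl
Graph-ext {suc n} {G , N} {H , M} G≗H =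
  cong₂ _,_ (Graph-ext (λ i j → G≗H (suc i) (suc j))) (Vec-ext (λ j → G≗H zero (suc j)))

fromAdj : ∀ {n} → (Fin n → Fin n → Bool) → Graph n
fromAdj {zero} f = tt
fromAdj {suc n} f = fromAdj (λ i j → f (suc i) (suc j)) , tabulate (λ j → f zero (suc j))

adj-fromAdj : ∀ {n} {f : Fin n → Fin n → Bool} → (∀ i j → f i j ≡ f j i) → (∀ i → f i i ≡ false) →
  ∀ i j → adj (fromAdj f) i j ≡ f i j
adj-fromAdj {suc n} f-sym f-irrefl zero zero = sym (f-irrefl zero)
adj-fromAdj {suc n} {f} f-sym f-irrefl zero (suc j) = lookup∘tabulate (λ j → f zero (suc j)) j
adj-fromAdj {suc n} {f} f-sym f-irrefl (suc i) zero =
  trans (lookup∘tabulate (λ j → f zero (suc j)) i) (f-sym zero (suc i))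
adj-fromAdj {suc n} f-sym f-irrefl (suc i) (suc j) =
  adj-fromAdj (λ i j → f-sym (suc i) (suc j)) (λ i → f-irrefl (suc i)) i j

T-not : ∀ {b} → T (not b) ⇔ (¬ T b)
T-not {true} = mk⇔ (λ ()) (λ ¬t → ⊥-elim (¬t tt))
T-not {false} = mk⇔ (λ _ ()) (λ _ → tt)

T-∀F : ∀ {n} {p : Fin n → Bool} → T (∀F p) ⇔ (∀ i → T (p i))
T-∀F {n} {p} = mk⇔ (All.tabulate⁻ ∘ to (T-foldr (allFin n))) (from (T-foldr (allFin n)) ∘ All.tabulate⁺)
  where
  T-foldr : ∀ is → T (foldr (λ i b → p i ∧ b) true is) ⇔ All (T ∘ p) is
  T-foldr [] = mk⇔ (λ _ → []) (λ _ → tt)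
  T-foldr (i ∷ is) = mk⇔ (λ t → let (pᵢ , rest) = to T-∧ t in pᵢ ∷ to (T-foldr is) rest)
                         (λ { (pᵢ ∷ rest) → from T-∧ (pᵢ , from (T-foldr is) rest) })

T-≠ : ∀ {n} {i j : Fin n} → T (i ≠ j) ⇔ (i ≢ j)
T-≠ = mk⇔ toWitnessFalse fromWitnessFalse

_∈ₛ_ : ∀ {n} → Fin n → Subset n → Set
i ∈ₛ S = T (lookup S i)

NoTriangle : ∀ {n} → Graph n → Set
NoTriangle G = ∀ a b c → T (adj G a b) → T (adj G b c) → T (adj G c a) → ⊥

NoFourCycle : ∀ {n} → Graph n → Set
NoFourCycle G = ∀ a b c d → T (adj G a b) → T (adj G b c) → T (adj G c d) → T (adj G d a) →
  a ≢ c → b ≢ d → ⊥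

IsStable : ∀ {n} → Graph n → Subset n → Set
IsStable G S = ∀ u v → u ∈ₛ S → v ∈ₛ S → T (adj G u v) → ⊥

NoCommonNbr : ∀ {n} → Graph n → Subset n → Set
NoCommonNbr G S = ∀ w u v → u ∈ₛ S → v ∈ₛ S → u ≢ v → T (adj G w u) → T (adj G w v) → ⊥

T-girth≥5 : ∀ {n} (G : Graph n) → T (girth≥5 G) ⇔ (NoTriangle G × NoFourCycle G)
T-girth≥5 G = mk⇔
  (λ t → let (t₃ , t₄) = to T-∧ t in noTriangle⇒ t₃ , noFourCycle⇒ t₄)
  (λ (h₃ , h₄) → from T-∧ (⇒noTriangle h₃ , ⇒noFourCycle h₄))
  where
  noTriangle⇒ : T (noTriangle G) → NoTriangle G
  noTriangle⇒ t a b c ab bc ca =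
    to T-not (to T-∀F (to T-∀F (to T-∀F t a) b) c) (from T-∧ (ab , from T-∧ (bc , ca)))
  ⇒noTriangle : NoTriangle G → T (noTriangle G)
  ⇒noTriangle h = from T-∀F λ a → from T-∀F λ b → from T-∀F λ c → from T-not λ t →
    let (ab , t′) = to T-∧ t ; (bc , ca) = to T-∧ t′ in h a b c ab bc ca
  noFourCycle⇒ : T (noFourCycle G) → NoFourCycle G
  noFourCycle⇒ t a b c d ab bc cd da a≢c b≢d =
    to T-not (to T-∀F (to T-∀F (to T-∀F (to T-∀F t a) b) c) d)
      (from T-∧ (ab , from T-∧ (bc , from T-∧ (cd , from T-∧ (da , from T-∧ (from T-≠ a≢c , from T-≠ b≢d))))))
  ⇒noFourCycle : NoFourCycle G → T (noFourCycle G)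
  ⇒noFourCycle h = from T-∀F λ a → from T-∀F λ b → from T-∀F λ c → from T-∀F λ d → from T-not λ t →
    let (ab , t₁) = to T-∧ t ; (bc , t₂) = to T-∧ t₁ ; (cd , t₃) = to T-∧ t₂ ; (da , t₄) = to T-∧ t₃
        (a≢c , b≢d) = to T-∧ t₄
    in h a b c d ab bc cd da (to T-≠ a≢c) (to T-≠ b≢d)

T-stable : ∀ {n} (G : Graph n) S → T (stable G S) ⇔ IsStable G S
T-stable G S = mk⇔
  (λ t u v u∈S v∈S uv → to T-not (to T-∀F (to T-∀F t u) v) (from T-∧ (u∈S , from T-∧ (v∈S , uv))))
  (λ h → from T-∀F λ u → from T-∀F λ v → from T-not λ t →
    let (u∈S , t′) = to T-∧ t ; (v∈S , uv) = to T-∧ t′ in h u v u∈S v∈S uv)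

T-noCommonNbr : ∀ {n} (G : Graph n) S → T (noCommonNbr G S) ⇔ NoCommonNbr G S
T-noCommonNbr G S = mk⇔
  (λ t w u v u∈S v∈S u≢v wu wv → to T-not (to T-∀F (to T-∀F (to T-∀F t w) u) v)
    (from T-∧ (u∈S , from T-∧ (v∈S , from T-∧ (from T-≠ u≢v , from T-∧ (wu , wv))))))
  (λ h → from T-∀F λ w → from T-∀F λ u → from T-∀F λ v → from T-not λ t →
    let (u∈S , t₁) = to T-∧ t ; (v∈S , t₂) = to T-∧ t₁ ; (u≢v , t₃) = to T-∧ t₂ ; (wu , wv) = to T-∧ t₃
    in h w u v u∈S v∈S (to T-≠ u≢v) wu wv)

scattered : ∀ {n} → Graph n → Subset n → Bool
scattered G S = stable G S ∧ noCommonNbr G S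

_⊆ₛ_ : ∀ {n} → Subset n → Subset n → Set
S ⊆ₛ S′ = ∀ {i} → i ∈ₛ S → i ∈ₛ S′

scattered-⊆ : ∀ {n} (G : Graph n) S S′ → S′ ⊆ₛ S → T (scattered G S) → T (scattered G S′)
scattered-⊆ G S S′ S′⊆S t = from T-∧ (stable′ , noCommonNbr′)
  where
  stable′ : T (stable G S′)
  stable′ = from (T-stable G S′) λ u v u∈ v∈ →
    to (T-stable G S) (proj₁ (to T-∧ t)) u v (S′⊆S u∈) (S′⊆S v∈)
  noCommonNbr′ : T (noCommonNbr G S′)
  noCommonNbr′ = from (T-noCommonNbr G S′) λ w u v u∈ v∈ →
    to (T-noCommonNbr G S) (proj₂ (to (T-∧ {stable G S}) t)) w u v (S′⊆S u∈) (S′⊆S v∈)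

shrink : ∀ {n} → ℕ → Subset n → Subset n
shrink k [] = []
shrink k (false ∷ S) = false ∷ shrink k S
shrink zero (true ∷ S) = false ∷ shrink zero S
shrink (suc k) (true ∷ S) = true ∷ shrink k S

∣shrink∣ : ∀ {n} k (S : Subset n) → k ≤ ∣ S ∣ → ∣ shrink k S ∣ ≡ k
∣shrink∣ zero [] z≤n = refl
∣shrink∣ k (false ∷ S) k≤∣S∣ = ∣shrink∣ k S k≤∣S∣
∣shrink∣ zero (true ∷ S) _ = ∣shrink∣ zero S z≤n
∣shrink∣ (suc k) (true ∷ S) (s≤s k≤∣S∣) = cong suc (∣shrink∣ k S k≤∣S∣)

shrink-⊆ : ∀ {n} k (S : Subset n) → shrink k S ⊆ₛ S
shrink-⊆ k (false ∷ S) {suc i} i∈ = shrink-⊆ k S i∈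
shrink-⊆ zero (true ∷ S) {suc i} i∈ = shrink-⊆ zero S i∈
shrink-⊆ (suc k) (true ∷ S) {zero} _ = tt
shrink-⊆ (suc k) (true ∷ S) {suc i} i∈ = shrink-⊆ k S i∈

rank : ∀ {n} (S : Subset n) → Fin n → Maybe (Fin ∣ S ∣)
rank (true ∷ S) zero = just zero
rank (false ∷ S) zero = nothing
rank (true ∷ S) (suc u) = Maybe.map suc (rank S u)
rank (false ∷ S) (suc u) = rank S u

enum : ∀ {n} (S : Subset n) → Fin ∣ S ∣ → Fin n
enum (true ∷ S) zero = zero
enum (true ∷ S) (suc i) = suc (enum S i)
enum (false ∷ S) i = suc (enum S i)

rank-enum : ∀ {n} (S : Subset n) i → rank S (enum S i) ≡ just i
rank-enum (true ∷ S) zero = refl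
rank-enum (true ∷ S) (suc i) = cong (Maybe.map suc) (rank-enum S i)
rank-enum (false ∷ S) i = rank-enum S i

enum-rank : ∀ {n} (S : Subset n) {u i} → rank S u ≡ just i → enum S i ≡ u
enum-rank (true ∷ S) {zero} refl = refl
enum-rank (true ∷ S) {suc u} eq with rank S u in r
enum-rank (true ∷ S) {suc u} refl | just j = cong suc (enum-rank S r)
enum-rank (false ∷ S) {suc u} eq = cong suc (enum-rank S eq)

rank-just⇒∈ : ∀ {n} (S : Subset n) {u i} → rank S u ≡ just i → u ∈ₛ S
rank-just⇒∈ (true ∷ S) {zero} _ = tt
rank-just⇒∈ (true ∷ S) {suc u} eq with rank S u in r
rank-just⇒∈ (true ∷ S) {suc u} refl | just j = rank-just⇒∈ S r
rank-just⇒∈ (false ∷ S) {suc u} eq = rank-just⇒∈ S eq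

rank-injective : ∀ {n} (S : Subset n) {u v i} → rank S u ≡ just i → rank S v ≡ just i → u ≡ v
rank-injective S ru rv = trans (sym (enum-rank S ru)) (enum-rank S rv)

RectangleFree : ∀ {P L} → (Fin P → Fin L → Bool) → Set
RectangleFree R = ∀ {p p′ l l′} → T (R p l) → T (R p′ l) → T (R p l′) → T (R p′ l′) → p ≡ p′ ⊎ l ≡ l′

module Bipartite {P L : ℕ} (R : Fin P → Fin L → Bool) where

  sideAdj : Fin P ⊎ Fin L → Fin P ⊎ Fin L → Bool
  sideAdj (inj₁ p) (inj₂ l) = R p l
  sideAdj (inj₂ l) (inj₁ p) = R p l
  sideAdj (inj₁ _) (inj₁ _) = false
  sideAdj (inj₂ _) (inj₂ _) = false

  sideAdj-sym : ∀ s t → sideAdj s t ≡ sideAdj t s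
  sideAdj-sym (inj₁ p) (inj₂ l) = refl
  sideAdj-sym (inj₂ l) (inj₁ p) = refl
  sideAdj-sym (inj₁ _) (inj₁ _) = refl
  sideAdj-sym (inj₂ _) (inj₂ _) = refl

  sideAdj-irrefl : ∀ s → sideAdj s s ≡ false
  sideAdj-irrefl (inj₁ _) = refl
  sideAdj-irrefl (inj₂ _) = refl

  sideAdj-noTriangle : ∀ s t u → T (sideAdj s t) → T (sideAdj t u) → T (sideAdj u s) → ⊥
  sideAdj-noTriangle (inj₁ _) (inj₂ _) (inj₁ _) _ _ ()
  sideAdj-noTriangle (inj₂ _) (inj₁ _) (inj₂ _) _ _ ()
  sideAdj-noTriangle (inj₁ _) (inj₁ _) _ () _ _
  sideAdj-noTriangle (inj₂ _) (inj₂ _) _ () _ _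
  sideAdj-noTriangle _ (inj₁ _) (inj₁ _) _ () _
  sideAdj-noTriangle _ (inj₂ _) (inj₂ _) _ () _

  sideAdj-noFourCycle : RectangleFree R → ∀ s t u v → T (sideAdj s t) → T (sideAdj t u) →
    T (sideAdj u v) → T (sideAdj v s) → s ≢ u → t ≢ v → ⊥
  sideAdj-noFourCycle rf (inj₁ p) (inj₂ l) (inj₁ p′) (inj₂ l′) pl lp′ p′l′ l′p s≢u t≢v
    with rf pl lp′ l′p p′l′
  ... | inj₁ refl = s≢u refl
  ... | inj₂ refl = t≢v refl
  sideAdj-noFourCycle rf (inj₂ l) (inj₁ p) (inj₂ l′) (inj₁ p′) lp pl′ l′p′ p′l s≢u t≢v
    with rf lp p′l pl′ l′p′
  ... | inj₁ refl = t≢v refl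
  ... | inj₂ refl = s≢u refl
  sideAdj-noFourCycle rf (inj₁ _) (inj₁ _) _ _ () _ _ _ _ _
  sideAdj-noFourCycle rf (inj₂ _) (inj₂ _) _ _ () _ _ _ _ _
  sideAdj-noFourCycle rf _ (inj₁ _) (inj₁ _) _ _ () _ _ _ _
  sideAdj-noFourCycle rf _ (inj₂ _) (inj₂ _) _ _ () _ _ _ _
  sideAdj-noFourCycle rf _ _ (inj₁ _) (inj₁ _) _ _ () _ _ _
  sideAdj-noFourCycle rf _ _ (inj₂ _) (inj₂ _) _ _ () _ _ _

  bipartite : Graph (P + L)
  bipartite = fromAdj (λ i j → sideAdj (splitAt P i) (splitAt P j))

  adj-bipartite : ∀ i j → adj bipartite i j ≡ sideAdj (splitAt P i) (splitAt P j)
  adj-bipartite = adj-fromAdj (λ i j → sideAdj-sym (splitAt P i) (splitAt P j)) (λ i → sideAdj-irrefl (splitAt P i))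

  adj-bipartite-↑ : ∀ p l → adj bipartite (p ↑ˡ L) (P ↑ʳ l) ≡ R p l
  adj-bipartite-↑ p l = trans (adj-bipartite (p ↑ˡ L) (P ↑ʳ l))
    (cong₂ sideAdj (Finₚ.splitAt-↑ˡ P p L) (Finₚ.splitAt-↑ʳ P L l))

  bipartite-girth≥5 : RectangleFree R → T (girth≥5 bipartite)
  bipartite-girth≥5 rf = from (T-girth≥5 bipartite)
    ( (λ a b c ab bc ca → sideAdj-noTriangle (side a) (side b) (side c) (edge ab) (edge bc) (edge ca))
    , (λ a b c d ab bc cd da a≢c b≢d → sideAdj-noFourCycle rf (side a) (side b) (side c) (side d)
         (edge ab) (edge bc) (edge cd) (edge da) (a≢c ∘ side-injective) (b≢d ∘ side-injective)))
    where
    side : Fin (P + L) → Fin P ⊎ Fin L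
    side = splitAt P
    side-injective : ∀ {i j} → side i ≡ side j → i ≡ j
    side-injective {i} {j} eq =
      trans (sym (Finₚ.join-splitAt P L i)) (trans (cong (join P L) eq) (Finₚ.join-splitAt P L j))
    edge : ∀ {i j} → T (adj bipartite i j) → T (sideAdj (side i) (side j))
    edge {i} {j} = subst T (adj-bipartite i j)

affine-coincide< : ∀ {x x′ a a′ b b′} → x < x′ →
  a * x + b ≡ a′ * x + b′ → a * x′ + b ≡ a′ * x′ + b′ → a ≡ a′ × b ≡ b′
affine-coincide< {x} {a = a} {a′} {b} {b′} x<x′ at-x at-x′ with m≤n⇒∃[o]m+o≡n x<x′
... | o , refl = a≡a′ , b≡b′
  where
  shift : ∀ a b → a * (suc x + o) + b ≡ (a * x + b) + a * suc o
  shift = solve 4 (λ x o a b → a :* (con 1 :+ x :+ o) :+ b := (a :* x :+ b) :+ a :* (con 1 :+ o)) refl x o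
  a≡a′ : a ≡ a′
  a≡a′ = *-cancelʳ-≡ a a′ (suc o) (+-cancelˡ-≡ (a * x + b) _ _ (begin
    (a * x + b) + a * suc o     ≡⟨ shift a b ⟨
    a * (suc x + o) + b         ≡⟨ at-x′ ⟩
    a′ * (suc x + o) + b′       ≡⟨ shift a′ b′ ⟩
    (a′ * x + b′) + a′ * suc o  ≡⟨ cong (_+ a′ * suc o) at-x ⟨
    (a * x + b) + a′ * suc o    ∎))
    where open ≡-Reasoning
  b≡b′ : b ≡ b′
  b≡b′ = +-cancelˡ-≡ (a * x) b b′ (trans at-x (cong (λ c → c * x + b′) (sym a≡a′)))

affine-coincide : ∀ {x x′ a a′ b b′} → x ≢ x′ →
  a * x + b ≡ a′ * x + b′ → a * x′ + b ≡ a′ * x′ + b′ → a ≡ a′ × b ≡ b′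
affine-coincide {x} {x′} x≢x′ at-x at-x′ with <-cmp x x′
... | tri< x<x′ _ _ = affine-coincide< x<x′ at-x at-x′
... | tri≈ _ x≡x′ _ = ⊥-elim (x≢x′ x≡x′)
... | tri> _ _ x′<x = affine-coincide< x′<x at-x′ at-x

remQuot-injective : ∀ {n} k {i j : Fin (n * k)} → remQuot {n} k i ≡ remQuot {n} k j → i ≡ j
remQuot-injective {n} k {i} {j} eq =
  trans (sym (Finₚ.combine-remQuot {n} k i)) (trans (cong (uncurry combine) eq) (Finₚ.combine-remQuot {n} k j))

-- Points (x, y), lines (a, b) (the line y = ax + b) and incidences (l, x) (the point of l above x)
-- are packed into Fin by combine/remQuot.
module AffineIncidences (w : ℕ) where

  heights points lines incidences : ℕ
  heights = w * w + w * w
  points = w * heights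
  lines = w * (w * w)
  incidences = lines * w

  xOf : Fin points → Fin w
  xOf p = proj₁ (remQuot {w} heights p)

  yOf : Fin points → Fin heights
  yOf p = proj₂ (remQuot {w} heights p)

  slope : Fin lines → Fin w
  slope l = proj₁ (remQuot {w} (w * w) l)

  intercept : Fin lines → Fin (w * w)
  intercept l = proj₂ (remQuot {w} (w * w) l)

  height : Fin lines → Fin w → ℕ
  height l x = toℕ (slope l) * toℕ x + toℕ (intercept l)

  height< : ∀ l x → height l x < heights
  height< l x = +-mono-< (*-mono-< (Finₚ.toℕ<n (slope l)) (Finₚ.toℕ<n x)) (Finₚ.toℕ<n (intercept l))

  onLine : Fin points → Fin lines → Bool
  onLine p l = toℕ (yOf p) ≡ᵇ height l (xOf p)

  onLine⇒ : ∀ {p l} → T (onLine p l) → toℕ (yOf p) ≡ height l (xOf p)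
  onLine⇒ {p} {l} = ≡ᵇ⇒≡ (toℕ (yOf p)) (height l (xOf p))

  onLine-rectangleFree : RectangleFree onLine
  onLine-rectangleFree {p} {p′} {l} {l′} pl p′l pl′ p′l′ with xOf p Finₚ.≟ xOf p′
  ... | yes x≡x′ = inj₁ (remQuot-injective heights (cong₂ _,_ x≡x′ (Finₚ.toℕ-injective (begin
    toℕ (yOf p)         ≡⟨ onLine⇒ pl ⟩
    height l (xOf p)    ≡⟨ cong (height l) x≡x′ ⟩
    height l (xOf p′)   ≡⟨ onLine⇒ p′l ⟨
    toℕ (yOf p′)        ∎))))
    where open ≡-Reasoning
  ... | no x≢x′ = inj₂ (remQuot-injective (w * w)
    (cong₂ _,_ (Finₚ.toℕ-injective (proj₁ same-line)) (Finₚ.toℕ-injective (proj₂ same-line))))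
    where
    same-line : toℕ (slope l) ≡ toℕ (slope l′) × toℕ (intercept l) ≡ toℕ (intercept l′)
    same-line = affine-coincide (x≢x′ ∘ Finₚ.toℕ-injective)
      (trans (sym (onLine⇒ pl)) (onLine⇒ pl′)) (trans (sym (onLine⇒ p′l)) (onLine⇒ p′l′))

  selected : Subset incidences → Fin points → Fin lines → Bool
  selected χ p l = onLine p l ∧ lookup χ (combine l (xOf p))

  selected-rectangleFree : ∀ χ → RectangleFree (selected χ)
  selected-rectangleFree χ pl p′l pl′ p′l′ =
    onLine-rectangleFree (proj₁ (to T-∧ pl)) (proj₁ (to T-∧ p′l)) (proj₁ (to T-∧ pl′)) (proj₁ (to T-∧ p′l′))

  lineOf : Fin incidences → Fin lines
  lineOf c = proj₁ (remQuot {lines} w c)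

  pointOf : Fin incidences → Fin points
  pointOf c = let (l , x) = remQuot {lines} w c in combine x (fromℕ< (height< l x))

  selected-incidence : ∀ χ c → selected χ (pointOf c) (lineOf c) ≡ lookup χ c
  selected-incidence χ c = begin
    selected χ (combine x y) l                       ≡⟨ selected-combine ⟩
    (toℕ y ≡ᵇ height l x) ∧ lookup χ (combine l x)   ≡⟨ cong (_∧ lookup χ (combine l x)) y-on-l ⟩
    lookup χ (combine l x)                           ≡⟨ cong (lookup χ) (Finₚ.combine-remQuot {lines} w c) ⟩
    lookup χ c                                       ∎
    where
    open ≡-Reasoning
    l = lineOf c
    x = proj₂ (remQuot {lines} w c)
    y = fromℕ< (height< l x)
    selected-combine : selected χ (combine x y) l ≡ ((toℕ y ≡ᵇ height l x) ∧ lookup χ (combine l x))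
    selected-combine = cong (λ (x′ , y′) → (toℕ y′ ≡ᵇ height l x′) ∧ lookup χ (combine l x′))
      (Finₚ.remQuot-combine {w} {heights} x y)
    y-on-l : (toℕ y ≡ᵇ height l x) ≡ true
    y-on-l = to T-≡ (≡⇒≡ᵇ (toℕ y) (height l x) (Finₚ.toℕ-fromℕ< (height< l x)))

  incidenceGraph : Subset incidences → Graph (points + lines)
  incidenceGraph χ = Bipartite.bipartite (selected χ)

  incidenceGraph-girth≥5 : ∀ χ → T (girth≥5 (incidenceGraph χ))
  incidenceGraph-girth≥5 χ = Bipartite.bipartite-girth≥5 (selected χ) (selected-rectangleFree χ)

  incidenceGraph-injective : ∀ {χ χ′} → incidenceGraph χ ≡ incidenceGraph χ′ → χ ≡ χ′
  incidenceGraph-injective {χ} {χ′} eq = Vec-ext λ c → begin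
    lookup χ c                                                         ≡⟨ adj-incidenceGraph χ c ⟨
    adj (incidenceGraph χ) (pointOf c ↑ˡ lines) (points ↑ʳ lineOf c)   ≡⟨ cong (λ G → adj G _ _) eq ⟩
    adj (incidenceGraph χ′) (pointOf c ↑ˡ lines) (points ↑ʳ lineOf c)  ≡⟨ adj-incidenceGraph χ′ c ⟩
    lookup χ′ c                                                        ∎
    where
    open ≡-Reasoning
    adj-incidenceGraph : ∀ χ c → adj (incidenceGraph χ) (pointOf c ↑ˡ lines) (points ↑ʳ lineOf c) ≡ lookup χ c
    adj-incidenceGraph χ c =
      trans (Bipartite.adj-bipartite-↑ (selected χ) (pointOf c) (lineOf c)) (selected-incidence χ c)

  incidenceGraphs : List (Graph (points + lines))
  incidenceGraphs = map incidenceGraph (allSubsets incidences)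

  incidenceGraphs-unique : Unique incidenceGraphs
  incidenceGraphs-unique = Unique.map⁺ incidenceGraph-injective (allSubsets-unique incidences)

  incidenceGraphs-girth≥5 : All (T ∘ girth≥5) incidenceGraphs
  incidenceGraphs-girth≥5 = All.map⁺ (All.universal incidenceGraph-girth≥5 (allSubsets incidences))

  length-incidenceGraphs : length incidenceGraphs ≡ 2 ^ incidences
  length-incidenceGraphs = trans (length-map incidenceGraph (allSubsets incidences)) (length-allSubsets incidences)

T-injective : ∀ {x y} → T x ⇔ T y → x ≡ y
T-injective {false} {false} _ = refl
T-injective {false} {true} x⇔y = ⊥-elim (from x⇔y tt)
T-injective {true} {false} x⇔y = ⊥-elim (to x⇔y tt)
T-injective {true} {true} _ = refl

girth5Scattered : ∀ {n} → Subset n → Graph n → Bool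
girth5Scattered S G = girth≥5 G ∧ scattered G S

module Planting {n : ℕ} (S : Subset n) where

  glue : Graph n → Graph ∣ S ∣ → (u v : Fin n) → Maybe (Fin ∣ S ∣) → Maybe (Fin ∣ S ∣) → Bool
  glue G H u v (just i) (just j) = adj H i j
  glue G H u v nothing nothing = adj G u v
  glue G H u v (just _) nothing = false
  glue G H u v nothing (just _) = false

  plantAdj : Graph n → Graph ∣ S ∣ → Fin n → Fin n → Bool
  plantAdj G H u v = glue G H u v (rank S u) (rank S v)

  plant : Graph n → Graph ∣ S ∣ → Graph n
  plant G H = fromAdj (plantAdj G H)

  adj-plant : ∀ G H u v → adj (plant G H) u v ≡ plantAdj G H u v
  adj-plant G H = adj-fromAdj plantAdj-sym plantAdj-irrefl
    where
    plantAdj-sym : ∀ u v → plantAdj G H u v ≡ plantAdj G H v u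
    plantAdj-sym u v with rank S u | rank S v
    ... | just i | just j = adj-sym H i j
    ... | nothing | nothing = adj-sym G u v
    ... | just _ | nothing = refl
    ... | nothing | just _ = refl
    plantAdj-irrefl : ∀ u → plantAdj G H u u ≡ false
    plantAdj-irrefl u with rank S u
    ... | just i = adj-irrefl H i
    ... | nothing = adj-irrefl G u

  plantAdj-inside : ∀ {G H u v i j} → rank S u ≡ just i → rank S v ≡ just j → plantAdj G H u v ≡ adj H i j
  plantAdj-inside ru rv rewrite ru | rv = refl

  plantAdj-outside : ∀ {G H u v} → rank S u ≡ nothing → rank S v ≡ nothing → plantAdj G H u v ≡ adj G u v
  plantAdj-outside ru rv rewrite ru | rv = refl

  plantAdj-noTriangle : ∀ {G H} → NoTriangle G → NoTriangle H → ∀ a b c →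
    T (plantAdj G H a b) → T (plantAdj G H b c) → T (plantAdj G H c a) → ⊥
  plantAdj-noTriangle G△ H△ a b c ab bc ca with rank S a | rank S b | rank S c
  ... | just i | just j | just k = H△ i j k ab bc ca
  ... | nothing | nothing | nothing = G△ a b c ab bc ca
  plantAdj-noTriangle G△ H△ a b c () bc ca | just _ | nothing | _
  plantAdj-noTriangle G△ H△ a b c () bc ca | nothing | just _ | _
  plantAdj-noTriangle G△ H△ a b c ab () ca | _ | just _ | nothing
  plantAdj-noTriangle G△ H△ a b c ab () ca | _ | nothing | just _

  plantAdj-noFourCycle : ∀ {G H} → NoFourCycle G → NoFourCycle H → ∀ a b c d →
    T (plantAdj G H a b) → T (plantAdj G H b c) → T (plantAdj G H c d) → T (plantAdj G H d a) →
    a ≢ c → b ≢ d → ⊥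
  plantAdj-noFourCycle G□ H□ a b c d ab bc cd da a≢c b≢d
    with rank S a in ra | rank S b in rb | rank S c in rc | rank S d in rd
  ... | just i | just j | just k | just l = H□ i j k l ab bc cd da
    (λ { refl → a≢c (rank-injective S ra rc) }) (λ { refl → b≢d (rank-injective S rb rd) })
  ... | nothing | nothing | nothing | nothing = G□ a b c d ab bc cd da a≢c b≢d
  plantAdj-noFourCycle G□ H□ a b c d () bc cd da a≢c b≢d | just _ | nothing | _ | _
  plantAdj-noFourCycle G□ H□ a b c d () bc cd da a≢c b≢d | nothing | just _ | _ | _
  plantAdj-noFourCycle G□ H□ a b c d ab () cd da a≢c b≢d | _ | just _ | nothing | _
  plantAdj-noFourCycle G□ H□ a b c d ab () cd da a≢c b≢d | _ | nothing | just _ | _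
  plantAdj-noFourCycle G□ H□ a b c d ab bc () da a≢c b≢d | _ | _ | just _ | nothing
  plantAdj-noFourCycle G□ H□ a b c d ab bc () da a≢c b≢d | _ | _ | nothing | just _

  plant-girth≥5 : ∀ {G H} → T (girth≥5 G) → T (girth≥5 H) → T (girth≥5 (plant G H))
  plant-girth≥5 {G} {H} G-girth H-girth = from (T-girth≥5 (plant G H))
    ( (λ a b c ab bc ca → plantAdj-noTriangle G△ H△ a b c (edge ab) (edge bc) (edge ca))
    , (λ a b c d ab bc cd da → plantAdj-noFourCycle G□ H□ a b c d (edge ab) (edge bc) (edge cd) (edge da)))
    where
    G△ = proj₁ (to (T-girth≥5 G) G-girth)
    G□ = proj₂ (to (T-girth≥5 G) G-girth)
    H△ = proj₁ (to (T-girth≥5 H) H-girth)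
    H□ = proj₂ (to (T-girth≥5 H) H-girth)
    edge : ∀ {u v} → T (adj (plant G H) u v) → T (plantAdj G H u v)
    edge {u} {v} = subst T (adj-plant G H u v)

  neighbour : Graph n → Fin n → Maybe (Fin n)
  neighbour G v with Finₚ.any? (λ u → T? (lookup S u ∧ adj G v u))
  ... | yes (u , _) = just u
  ... | no _ = nothing

  neighbour-spec : ∀ {G} → NoCommonNbr G S → ∀ v {u} → u ∈ₛ S → T (adj G v u) ⇔ (neighbour G v ≡ just u)
  neighbour-spec {G} noCommon v {u} u∈S = mk⇔ adj⇒neighbour neighbour⇒adj
    where
    adj⇒neighbour : T (adj G v u) → neighbour G v ≡ just u
    adj⇒neighbour vu with Finₚ.any? (λ u → T? (lookup S u ∧ adj G v u))
    ... | no none = ⊥-elim (none (u , from T-∧ (u∈S , vu)))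
    ... | yes (u′ , t) with u′ Finₚ.≟ u
    ...   | yes refl = refl
    ...   | no u′≢u = ⊥-elim (noCommon v u′ u (proj₁ (to T-∧ t)) u∈S u′≢u (proj₂ (to T-∧ t)) vu)
    neighbour⇒adj : neighbour G v ≡ just u → T (adj G v u)
    neighbour⇒adj eq with Finₚ.any? (λ u → T? (lookup S u ∧ adj G v u))
    neighbour⇒adj refl | yes (u′ , t) = proj₂ (to T-∧ t)

  -- Since S is scattered, this record determines every edge between S and its complement.
  neighbours : Graph n → Vec (Maybe (Fin n)) n
  neighbours G = tabulate (neighbour G)

  plant-injective : ∀ {G₁ G₂ H₁ H₂} → T (scattered G₁ S) → T (scattered G₂ S) →
    plant G₁ H₁ ≡ plant G₂ H₂ → neighbours G₁ ≡ neighbours G₂ → G₁ ≡ G₂ × H₁ ≡ H₂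
  plant-injective {G₁} {G₂} {H₁} {H₂} scattered₁ scattered₂ planted recorded = Graph-ext G₁≗G₂ , Graph-ext H₁≗H₂
    where
    same-plantAdj : ∀ u v → plantAdj G₁ H₁ u v ≡ plantAdj G₂ H₂ u v
    same-plantAdj u v =
      trans (sym (adj-plant G₁ H₁ u v)) (trans (cong (λ G → adj G u v) planted) (adj-plant G₂ H₂ u v))
    same-neighbour : ∀ v → neighbour G₁ v ≡ neighbour G₂ v
    same-neighbour v = trans (sym (lookup∘tabulate (neighbour G₁) v))
      (trans (cong (λ ν → lookup ν v) recorded) (lookup∘tabulate (neighbour G₂) v))
    towards-S : ∀ v {u} → u ∈ₛ S → adj G₁ v u ≡ adj G₂ v u
    towards-S v u∈S = T-injective (mk⇔
      (λ vu → from spec₂ (trans (sym (same-neighbour v)) (to spec₁ vu)))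
      (λ vu → from spec₁ (trans (same-neighbour v) (to spec₂ vu))))
      where
      spec₁ = neighbour-spec (to (T-noCommonNbr G₁ S) (proj₂ (to (T-∧ {stable G₁ S}) scattered₁))) v u∈S
      spec₂ = neighbour-spec (to (T-noCommonNbr G₂ S) (proj₂ (to (T-∧ {stable G₂ S}) scattered₂))) v u∈S
    inside-S : ∀ {u v} → u ∈ₛ S → v ∈ₛ S → adj G₁ u v ≡ adj G₂ u v
    inside-S {u} {v} u∈S v∈S = T-injective (mk⇔
      (⊥-elim ∘ to (T-stable G₁ S) (proj₁ (to T-∧ scattered₁)) u v u∈S v∈S)
      (⊥-elim ∘ to (T-stable G₂ S) (proj₁ (to T-∧ scattered₂)) u v u∈S v∈S))
    G₁≗G₂ : ∀ u v → adj G₁ u v ≡ adj G₂ u v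
    G₁≗G₂ u v with rank S u in ru | rank S v in rv
    ... | nothing | nothing =
      trans (sym (plantAdj-outside ru rv)) (trans (same-plantAdj u v) (plantAdj-outside ru rv))
    ... | just _ | just _ = inside-S (rank-just⇒∈ S ru) (rank-just⇒∈ S rv)
    ... | just _ | nothing = trans (adj-sym G₁ u v) (trans (towards-S v (rank-just⇒∈ S ru)) (adj-sym G₂ v u))
    ... | nothing | just _ = towards-S u (rank-just⇒∈ S rv)
    H₁≗H₂ : ∀ i j → adj H₁ i j ≡ adj H₂ i j
    H₁≗H₂ i j = trans (sym (plantAdj-inside (rank-enum S i) (rank-enum S j)))
      (trans (same-plantAdj (enum S i) (enum S j)) (plantAdj-inside (rank-enum S i) (rank-enum S j)))

  hosts-bound : (Hs : List (Graph ∣ S ∣)) → Unique Hs → All (T ∘ girth≥5) Hs →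
    countᵇ (girth5Scattered S) (allGraphs n) * length Hs ≤ suc n ^ n * countGirth5 n
  hosts-bound Hs Hs-unique Hs-girth≥5 = begin
    length hosts * length Hs                     ≡⟨ length-cartesianProductWith _,_ hosts Hs ⟨
    length (cartesianProduct hosts Hs)           ≤⟨ length-≤-injectiveOn encode domain-unique encode-injective encode-into ⟩
    length (cartesianProduct girth5 records)     ≡⟨ length-cartesianProductWith _,_ girth5 records ⟩
    countGirth5 n * length records               ≡⟨ cong (countGirth5 n *_) length-records ⟩
    countGirth5 n * suc n ^ n                    ≡⟨ *-comm (countGirth5 n) (suc n ^ n) ⟩
    suc n ^ n * countGirth5 n                    ∎
    where
    open ≤-Reasoning
    hosts = filterᵇ (girth5Scattered S) (allGraphs n)
    girth5 = filterᵇ girth≥5 (allGraphs n)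
    records = vectors (allMaybeFin n) n
    length-records : length records ≡ suc n ^ n
    length-records = trans (length-vectors (allMaybeFin n) n) (cong (_^ n) (length-allMaybeFin n))
    encode : Graph n × Graph ∣ S ∣ → Graph n × Vec (Maybe (Fin n)) n
    encode (G , H) = plant G H , neighbours G
    domain-unique : Unique (cartesianProduct hosts Hs)
    domain-unique = Unique.cartesianProduct⁺ (Unique.filter⁺ (T? ∘ girth5Scattered S) (allGraphs-unique n)) Hs-unique
    host : ∀ {G H} → (G , H) ∈ cartesianProduct hosts Hs → T (girth≥5 G) × T (scattered G S) × T (girth≥5 H)
    host {G} {H} GH∈ =
      let (G∈ , H∈) = ∈-cartesianProduct⁻ hosts Hs GH∈
          (G-girth≥5 , G-scattered) = to (T-∧ {girth≥5 G}) (proj₂ (∈-filter⁻ (T? ∘ girth5Scattered S) {xs = allGraphs n} G∈))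
      in G-girth≥5 , G-scattered , All.lookup Hs-girth≥5 H∈
    encode-injective : ∀ {x y} → x ∈ cartesianProduct hosts Hs → y ∈ cartesianProduct hosts Hs →
      encode x ≡ encode y → x ≡ y
    encode-injective {G₁ , H₁} {G₂ , H₂} x∈ y∈ eq
      with plant-injective (proj₁ (proj₂ (host x∈))) (proj₁ (proj₂ (host y∈))) (cong proj₁ eq) (cong proj₂ eq)
    ... | refl , refl = refl
    encode-into : ∀ {x} → x ∈ cartesianProduct hosts Hs → encode x ∈ cartesianProduct girth5 records
    encode-into {G , H} x∈ = let (G-girth≥5 , _ , H-girth≥5) = host x∈ in ∈-cartesianProduct⁺
      (∈-filter⁺ (T? ∘ girth≥5) (∈-allGraphs (plant G H)) (plant-girth≥5 G-girth≥5 H-girth≥5))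
      (∈-vectors ∈-allMaybeFin (neighbours G))

plantingBound : ∀ {n K} (S : Subset n) → ∣ S ∣ ≡ K → (Hs : List (Graph K)) → Unique Hs → All (T ∘ girth≥5) Hs →
  countᵇ (girth5Scattered S) (allGraphs n) * length Hs ≤ suc n ^ n * countGirth5 n
plantingBound S refl = Planting.hosts-bound S

<foldr-⊔⇒∃ : ∀ {k} (xs : List ℕ) → k < foldr _⊔_ 0 xs → ∃[ x ] x ∈ xs × k < x
<foldr-⊔⇒∃ [] ()
<foldr-⊔⇒∃ (x ∷ xs) k< with ⊔-sel x (foldr _⊔_ 0 xs)
... | inj₁ eq = x , here refl , subst (_ <_) eq k<
... | inj₂ eq = let (y , y∈ , k<y) = <foldr-⊔⇒∃ xs (subst (_ <_) eq k<) in y , there y∈ , k<y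

scattered-of-size : ∀ {n} (G : Graph n) {k} → k < s G → ∃[ S ] T (scattered G S) × ∣ S ∣ ≡ k
scattered-of-size {n} G {k} k<s =
  let (m , m∈ , k<m) = <foldr-⊔⇒∃ _ k<s
      (S , _ , m≡∣S∣ , S-scattered) = ∈-map∘filter⁻ ∣_∣ (T? ∘ scattered G) {xs = allSubsets n} m∈
      k≤∣S∣ = ≤-trans (<⇒≤ k<m) (≤-reflexive m≡∣S∣)
  in shrink k S , scattered-⊆ G S (shrink k S) (shrink-⊆ k S) S-scattered , ∣shrink∣ k S k≤∣S∣

bigS⇒<s : ∀ {n K} (G : Graph n) → K ^ 10 ≤ 3 ^ 10 * n ^ 9 → T (bigS G) → K < s G
bigS⇒<s {n} G K-small big = ≰⇒> λ s≤K →
  <⇒≱ (toWitness {a? = 3 ^ 10 * n ^ 9 <? s G ^ 10} big) (≤-trans (^-monoˡ-≤ 10 s≤K) K-small)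

countBad-bound : ∀ {n K} (Hs : List (Graph K)) → Unique Hs → All (T ∘ girth≥5) Hs →
  K ^ 10 ≤ 3 ^ 10 * n ^ 9 → countBad n * length Hs ≤ 2 ^ n * suc n ^ n * countGirth5 n
countBad-bound {n} {K} Hs Hs-unique Hs-girth≥5 K-small = begin
  countBad n * length Hs
    ≤⟨ *-monoˡ-≤ (length Hs) (countᵇ-≤-sum bad girth5Scattered candidates covered (allGraphs n)) ⟩
  sum (map (λ S → countᵇ (girth5Scattered S) (allGraphs n)) candidates) * length Hs
    ≤⟨ sum-map-*-≤ (λ S → countᵇ (girth5Scattered S) (allGraphs n)) (length Hs) _ candidates per-candidate ⟩
  length candidates * (suc n ^ n * countGirth5 n)
    ≤⟨ *-monoˡ-≤ _ candidates-≤ ⟩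
  2 ^ n * (suc n ^ n * countGirth5 n)
    ≡⟨ *-assoc (2 ^ n) (suc n ^ n) (countGirth5 n) ⟨
  2 ^ n * suc n ^ n * countGirth5 n ∎
  where
  open ≤-Reasoning
  bad : Graph n → Bool
  bad G = girth≥5 G ∧ bigS G
  hasSize : Subset n → Bool
  hasSize S = ∣ S ∣ ≡ᵇ K
  candidates = filterᵇ hasSize (allSubsets n)
  candidates-≤ : length candidates ≤ 2 ^ n
  candidates-≤ = ≤-trans (length-filter (T? ∘ hasSize) (allSubsets n)) (≤-reflexive (length-allSubsets n))
  per-candidate : ∀ {S} → S ∈ candidates →
    countᵇ (girth5Scattered S) (allGraphs n) * length Hs ≤ suc n ^ n * countGirth5 n
  per-candidate {S} S∈ =
    plantingBound S (≡ᵇ⇒≡ _ _ (proj₂ (∈-filter⁻ (T? ∘ hasSize) {xs = allSubsets n} S∈))) Hs Hs-unique Hs-girth≥5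
  covered : ∀ {G} → T (bad G) → Any (λ S → T (girth5Scattered S G)) candidates
  covered {G} t =
    let (G-girth≥5 , big) = to (T-∧ {girth≥5 G}) t
        (S , S-scattered , ∣S∣≡K) = scattered-of-size G (bigS⇒<s G K-small big)
    in lose (∈-filter⁺ (T? ∘ hasSize) (∈-allSubsets S) (≡⇒≡ᵇ _ _ ∣S∣≡K)) (from T-∧ (G-girth≥5 , S-scattered))

integerRoot : ∀ k .{{_ : NonZero k}} n → ∃[ r ] r ^ k ≤ n × n < suc r ^ k
integerRoot k zero = 0 , ≤-reflexive (0^n≡0 k) , m^n>0 1 k
  where
  0^n≡0 : ∀ k .{{_ : NonZero k}} → 0 ^ k ≡ 0
  0^n≡0 (suc k) = refl
integerRoot k (suc n) with integerRoot k n
... | r , r^k≤n , n<[1+r]^k with m≤n⇒m<n∨m≡n n<[1+r]^k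
...   | inj₁ 1+n<[1+r]^k = r , m≤n⇒m≤1+n r^k≤n , 1+n<[1+r]^k
...   | inj₂ 1+n≡[1+r]^k = suc r , ≤-reflexive (sym 1+n≡[1+r]^k) ,
          subst (_< suc (suc r) ^ k) (sym 1+n≡[1+r]^k) (^-monoˡ-< k (n<1+n (suc r)))

n<2^n : ∀ n → n < 2 ^ n
n<2^n zero = s≤s z≤n
n<2^n (suc n) = begin-strict
  suc n            <⟨ +-mono-≤-< (m^n>0 2 n) (n<2^n n) ⟩
  2 ^ n + 2 ^ n    ≡⟨ cong (2 ^ n +_) (+-identityʳ (2 ^ n)) ⟨
  2 ^ suc n        ∎
  where open ≤-Reasoning

*-≤-transfer : ∀ {x y z a b} .{{_ : NonZero z}} → x * b ≤ z * y → a * z ≤ b → x * a ≤ y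
*-≤-transfer {x} {y} {z} {a} {b} xb≤zy az≤b = *-cancelʳ-≤ (x * a) y z (begin
  x * a * z    ≡⟨ *-assoc x a z ⟩
  x * (a * z)  ≤⟨ *-monoʳ-≤ x az≤b ⟩
  x * b        ≤⟨ xb≤zy ⟩
  z * y        ≡⟨ *-comm z y ⟩
  y * z        ∎)
  where open ≤-Reasoning

exponent-bound : ∀ C r n → 1024 * (C + 21) ≤ r → n < suc r ^ 10 → C * n + (n + suc r * 10 * n) ≤ r ^ 12
exponent-bound C r n r-large n<[1+r]^10 = begin
  C * n + (n + suc r * 10 * n)        ≡⟨ collect C r n ⟩
  (C + 11 + 10 * r) * n               ≤⟨ *-mono-≤ coefficient≤ n≤ ⟩
  (C + 21) * r * (1024 * r ^ 10)      ≡⟨ regroup C r ⟩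
  1024 * (C + 21) * r ^ 11            ≤⟨ *-monoˡ-≤ (r ^ 11) r-large ⟩
  r * r ^ 11                          ∎
  where
  open ≤-Reasoning
  collect : ∀ C r n → C * n + (n + suc r * 10 * n) ≡ (C + 11 + 10 * r) * n
  collect = solve 3 (λ C r n → C :* n :+ (n :+ (con 1 :+ r) :* con 10 :* n) := (C :+ con 11 :+ con 10 :* r) :* n) refl
  regroup : ∀ C r → (C + 21) * r * (1024 * r ^ 10) ≡ 1024 * (C + 21) * r ^ 11
  regroup = solve 2 (λ C r → (C :+ con 21) :* r :* (con 1024 :* r :^ 10) := con 1024 :* (C :+ con 21) :* r :^ 11) refl
  1≤r : 1 ≤ r
  1≤r = ≤-trans (≤-trans (s≤s z≤n) (m≤n+m 21 C)) (≤-trans (m≤n*m (C + 21) 1024) r-large)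
  coefficient≤ : C + 11 + 10 * r ≤ (C + 21) * r
  coefficient≤ = begin
    C + 11 + 10 * r            ≡⟨ cong (_+ 10 * r) (*-identityʳ (C + 11)) ⟨
    (C + 11) * 1 + 10 * r      ≤⟨ +-monoˡ-≤ (10 * r) (*-monoʳ-≤ (C + 11) 1≤r) ⟩
    (C + 11) * r + 10 * r      ≡⟨ *-distribʳ-+ r (C + 11) 10 ⟨
    (C + 11 + 10) * r          ≡⟨ cong (_* r) (+-assoc C 11 10) ⟩
    (C + 21) * r               ∎
  n≤ : n ≤ 1024 * r ^ 10
  n≤ = begin
    n                  ≤⟨ <⇒≤ n<[1+r]^10 ⟩
    suc r ^ 10         ≤⟨ ^-monoˡ-≤ 10 (+-monoˡ-≤ r 1≤r) ⟩
    (r + r) ^ 10       ≡⟨ solve 1 (λ r → (r :+ r) :^ 10 := con 1024 :* r :^ 10) refl r ⟩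
    1024 * r ^ 10      ∎

[1+n]^n≤ : ∀ r n → n < suc r ^ 10 → suc n ^ n ≤ 2 ^ (suc r * 10 * n)
[1+n]^n≤ r n n<[1+r]^10 = begin
  suc n ^ n                ≤⟨ ^-monoˡ-≤ n 1+n≤ ⟩
  (2 ^ (suc r * 10)) ^ n   ≡⟨ ^-*-assoc 2 (suc r * 10) n ⟩
  2 ^ (suc r * 10 * n)     ∎
  where
  open ≤-Reasoning
  1+n≤ : suc n ≤ 2 ^ (suc r * 10)
  1+n≤ = begin
    suc n               ≤⟨ n<[1+r]^10 ⟩
    suc r ^ 10          ≤⟨ ^-monoˡ-≤ 10 (<⇒≤ (n<2^n (suc r))) ⟩
    (2 ^ suc r) ^ 10    ≡⟨ ^-*-assoc 2 (suc r) 10 ⟩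
    2 ^ (suc r * 10)    ∎

2^Cn*2^n*[1+n]^n≤2^r^12 : ∀ C r n → 1024 * (C + 21) ≤ r → n < suc r ^ 10 → 2 ^ (C * n) * (2 ^ n * suc n ^ n) ≤ 2 ^ (r ^ 12)
2^Cn*2^n*[1+n]^n≤2^r^12 C r n r-large n<[1+r]^10 = begin
  2 ^ (C * n) * (2 ^ n * suc n ^ n)
    ≤⟨ *-monoʳ-≤ (2 ^ (C * n)) (*-monoʳ-≤ (2 ^ n) ([1+n]^n≤ r n n<[1+r]^10)) ⟩
  2 ^ (C * n) * (2 ^ n * 2 ^ (suc r * 10 * n))
    ≡⟨ cong (2 ^ (C * n) *_) (^-distribˡ-+-* 2 n _) ⟨
  2 ^ (C * n) * 2 ^ (n + suc r * 10 * n)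
    ≡⟨ ^-distribˡ-+-* 2 (C * n) _ ⟨
  2 ^ (C * n + (n + suc r * 10 * n))
    ≤⟨ ^-monoʳ-≤ 2 (exponent-bound C r n r-large n<[1+r]^10) ⟩
  2 ^ (r ^ 12) ∎
  where open ≤-Reasoning


^-distribʳ-* : ∀ a b k → (a * b) ^ k ≡ a ^ k * b ^ k
^-distribʳ-* a b zero = refl
^-distribʳ-* a b (suc k) = begin
  a * b * (a * b) ^ k        ≡⟨ cong (a * b *_) (^-distribʳ-* a b k) ⟩
  a * b * (a ^ k * b ^ k)    ≡⟨ solve 4 (λ a b x y → a :* b :* (x :* y) := a :* x :* (b :* y)) refl a b (a ^ k) (b ^ k) ⟩
  a * a ^ k * (b * b ^ k)    ∎
  where open ≡-Reasoning

countBad-incidenceBound : ∀ r n → r ^ 10 ≤ n → countBad n * 2 ^ (r ^ 12) ≤ 2 ^ n * suc n ^ n * countGirth5 n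
countBad-incidenceBound r n r^10≤n =
  subst (λ m → countBad n * m ≤ 2 ^ n * suc n ^ n * countGirth5 n) (trans length-incidenceGraphs (cong (2 ^_) incidences≡))
    (countBad-bound {n} incidenceGraphs incidenceGraphs-unique incidenceGraphs-girth≥5 vertices-small)
  where
  open AffineIncidences (r ^ 3)
  incidences≡ : incidences ≡ r ^ 12
  incidences≡ = solve 1 (λ r → r :^ 3 :* (r :^ 3 :* r :^ 3) :* r :^ 3 := r :^ 12) refl r
  vertices≡ : points + lines ≡ 3 * r ^ 9
  vertices≡ = solve 1 (λ r → r :^ 3 :* (r :^ 3 :* r :^ 3 :+ r :^ 3 :* r :^ 3) :+ r :^ 3 :* (r :^ 3 :* r :^ 3)
                               := con 3 :* r :^ 9) refl r
  vertices-small : (points + lines) ^ 10 ≤ 3 ^ 10 * n ^ 9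
  vertices-small = begin
    (points + lines) ^ 10   ≡⟨ cong (_^ 10) vertices≡ ⟩
    (3 * r ^ 9) ^ 10        ≡⟨ ^-distribʳ-* 3 (r ^ 9) 10 ⟩
    3 ^ 10 * (r ^ 9) ^ 10   ≡⟨ cong (3 ^ 10 *_) (trans (^-*-assoc r 9 10) (sym (^-*-assoc r 10 9))) ⟩
    3 ^ 10 * (r ^ 10) ^ 9   ≤⟨ *-monoʳ-≤ (3 ^ 10) (^-monoˡ-≤ 9 r^10≤n) ⟩
    3 ^ 10 * n ^ 9          ∎
    where open ≤-Reasoning

mainTheorem14 : (C : ℕ) → ∃ λ N → (n : ℕ) → n ≥ N →
    countBad n * 2 ^ (C * n) ≤ countGirth5 n
mainTheorem14 C = R ^ 10 , λ n n≥R^10 →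
  let (r , r^10≤n , n<[1+r]^10) = integerRoot 10 n
      R≤r : R ≤ r
      R≤r = ≮⇒≥ λ r<R → <⇒≱ n<[1+r]^10 (≤-trans (^-monoˡ-≤ 10 r<R) n≥R^10)
  in *-≤-transfer {countBad n} {a = 2 ^ (C * n)} {{m*n≢0 (2 ^ n) (suc n ^ n) {{m^n≢0 2 n}} {{m^n≢0 (suc n) n}}}}
       (countBad-incidenceBound r n r^10≤n) (2^Cn*2^n*[1+n]^n≤2^r^12 C r n R≤r n<[1+r]^10)
  where
  R = 1024 * (C + 21)
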